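{- Let $F$ be a 2-CNF formula containing no semicomplete sub-multiset of clauses, and let $G^0$ be as defined in the context. A variable $x\in\mathrm{var}(F)$ is insignificant if and only if $x$ is an isolated vertex of $G^0$ and $w(x)=0$.
   Context: A literal is a variable $x$ or its negation $\overline{x}$. A clause is a finite set of literals with no complementary pair; a 2-CNF formula is a finite multiset of clauses each with exactly 2 literals; clause $\{p,q\}$ is written $pq$. $\mathrm{var}(F)$ is the set of variables of $F$, $\mathrm{var}(C)$ those of clause $C$. Two distinct clauses $Y,Z$ have a conflict if some $p\in Y$ has $\overline{p}\in Z$; a 2-CNF formula is semicomplete if it has exactly 4 clauses and every pair of distinct clauses has a conflict. For a literal $p$, $c(p)$ is the number of clauses of $F$ containing $p$; $c(pq)$ is the number of occurrences of clause $pq$ in $F$. A variable $x$ is insignificant if for each literal $y$, $c(xy)=c(\overline{x}y)$; otherwise it is significant. The auxiliary graph $G=(V,E)$ has $V=\mathrm{var}(F)$ and $xy\in E$ iff some clause $C\in F$ has $\mathrm{var}(C)=\{x,y\}$. Weights: $w(x)=c(x)-c(\overline{x})$ for vertices and $w(xy)=c(x\overline{y})+c(\overline{x}y)-c(xy)-c(\overline{x}\,\overline{y})$ for edges. $G^0$ is obtained from $G$ by removing all edges of weight zero. -}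

module Defs where

open import Data.Nat using (ℕ; _≟_)
open import Data.Bool using (Bool; true; false; not; _∧_; _∨_; if_then_else_)
open import Data.Bool.Properties using () renaming (_≟_ to _≟ᵇ_)
open import Data.Fin using (Fin)
open import Data.List using (List; length; lookup; filter)
open import Data.List.Relation.Unary.Any using (Any)
open import Data.Integer using (ℤ; +_; _-_)
open import Data.Product using (Σ; _×_; _,_)
open import Data.Sum using (_⊎_)
open import Relation.Binary.PropositionalEquality using (_≡_; _≢_)
open import Relation.Nullary.Decidable using (⌊_⌋)

-- Variables are natural numbers.  A literal is a variable with a polarity
-- (true = positive literal x, false = negative literal x̄).
record Lit : Set where
  constructor mkLit
  field
    var : ℕ
    pol : Bool
open Lit public

neg : Lit → Lit
neg (mkLit x b) = mkLit x (not b)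

posLit : ℕ → Lit
posLit x = mkLit x true

_==_ : Lit → Lit → Bool
mkLit x b == mkLit y c = ⌊ x ≟ y ⌋ ∧ ⌊ b ≟ᵇ c ⌋

-- Having exactly two literals and no
-- complementary pair amounts to the two literals having distinct variables.
-- The clause is the (unordered) set {l₁,l₂}; the order of the fields is
-- irrelevant for everything below.
record Clause : Set where
  constructor mkClause
  field
    l₁ : Lit
    l₂ : Lit
    distinct : var l₁ ≢ var l₂
open Clause public

-- A 2-CNF formula: a finite multiset of clauses, represented as a list.
Formula : Set
Formula = List Clause

_∈C_ : Lit → Clause → Set
p ∈C C = (p ≡ l₁ C) ⊎ (p ≡ l₂ C)

Conflict : Clause → Clause → Set
Conflict Y Z = Σ Lit λ p → (p ∈C Y) × (neg p ∈C Z)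

ContainsSemicomplete : Formula → Set
ContainsSemicomplete F =
  Σ (Fin 4 → Fin (length F)) λ s →
    ((a b : Fin 4) → s a ≡ s b → a ≡ b) ×
    ((a b : Fin 4) → a ≢ b → Conflict (lookup F (s a)) (lookup F (s b)))

containsᵇ : Lit → Clause → Bool
containsᵇ p C = (p == l₁ C) ∨ (p == l₂ C)

isClauseᵇ : Lit → Lit → Clause → Bool
isClauseᵇ p q C = ((l₁ C == p) ∧ (l₂ C == q)) ∨ ((l₁ C == q) ∧ (l₂ C == p))

countᵇ : (Clause → Bool) → Formula → ℕ
countᵇ f List.[] = 0
countᵇ f (C List.∷ F) = if f C then Data.Nat.suc (countᵇ f F) else countᵇ f F

c₁ : Formula → Lit → ℕ
c₁ F p = countᵇ (containsᵇ p) F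

c₂ : Formula → Lit → Lit → ℕ
c₂ F p q = countᵇ (isClauseᵇ p q) F

Insignificant : Formula → ℕ → Set
Insignificant F x = (y : Lit) → c₂ F (posLit x) y ≡ c₂ F (neg (posLit x)) y

_∈Var_ : ℕ → Formula → Set
x ∈Var F = Any (λ C → (var (l₁ C) ≡ x) ⊎ (var (l₂ C) ≡ x)) F

Edge : Formula → ℕ → ℕ → Set
Edge F x y = Any (λ C → ((var (l₁ C) ≡ x) × (var (l₂ C) ≡ y))
                      ⊎ ((var (l₁ C) ≡ y) × (var (l₂ C) ≡ x))) F

wV : Formula → ℕ → ℤ
wV F x = + c₁ F (mkLit x true) - + c₁ F (mkLit x false)

wE : Formula → ℕ → ℕ → ℤ
wE F x y = (+ (c₂ F (mkLit x true) (mkLit y false) Data.Nat.+ c₂ F (mkLit x false) (mkLit y true)))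
         - (+ (c₂ F (mkLit x true) (mkLit y true) Data.Nat.+ c₂ F (mkLit x false) (mkLit y false)))

-- x is an isolated vertex of G⁰ (G with all weight-zero edges removed):
-- every edge of G at x has weight zero.
IsolatedInG⁰ : Formula → ℕ → Set
IsolatedInG⁰ F x = (y : ℕ) → Edge F x y → wE F x y ≡ + 0

module Submission where

-- Write a, b, c, d for the "profile" v ↦ c(xv), c(xv̄), c(x̄v), c(x̄v̄);
-- insignificance says a = c and b = d.  Since w(xv) = (b + c) − (a + d) and
-- all four counts vanish off the edges of G, isolation in G⁰ says that
-- b + c = a + d everywhere (the profile is balanced); since
-- c(p) = Σ_v (c(pv) + c(pv̄)), w(x) = Σ (a + b) − Σ (c + d).  So (⇒) is
-- direct.  For (⇐): if a(v) > c(v) then also b(v) > d(v), so a(v), b(v) > 0;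
-- with no semicomplete set {xv, xv̄, x̄u, x̄ū} every u has c(u) = 0 or
-- d(u) = 0, hence c(u) + d(u) ≤ a(u) + b(u), strictly at v, contradicting
-- w(x) = 0.  The case a(v) < c(v) is symmetric.

open import Defs
open import Data.Nat using (ℕ)
open import Data.Integer using (+_)
open import Data.Product using (_×_)
open import Function.Bundles using (_⇔_)
open import Relation.Nullary using (¬_)
open import Relation.Binary.PropositionalEquality using (_≡_)

open import Data.Bool using (Bool; true; false)
open import Data.Bool.Properties using (∧-zeroʳ; ∧-identityʳ; ∨-identityʳ; not-¬) renaming (_≟_ to _≟ᵇ_)
open import Data.Empty using (⊥; ⊥-elim)
open import Data.Fin using (Fin) renaming (zero to #0; suc to #s)
import Data.Fin as Fin
import Data.Integer.Properties as ℤ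
open import Data.List using ([]; _∷_; length; lookup)
open import Data.List.Membership.Propositional using (lose)
open import Data.List.Membership.Propositional.Properties using (∈-lookup)
open import Data.List.Relation.Unary.All as All using (All; _∷_)
open import Data.List.Relation.Unary.Any using (any?)
open import Data.Nat using (zero; suc; _+_; _⊔_; _≤_; _<_; _≟_; z≤n; s≤s)
open import Data.Nat.Properties
open import Algebra.Properties.CommutativeSemigroup +-commutativeSemigroup using (interchange)
open import Data.Product using (Σ; _,_; proj₁; proj₂)
open import Data.Sum using (_⊎_; inj₁; inj₂)
open import Function.Bundles using (mk⇔)
open import Relation.Binary.Definitions using (tri<; tri≈; tri>)
open import Relation.Binary.PropositionalEquality
  using (_≢_; refl; sym; trans; cong; cong₂; subst; module ≡-Reasoning)
open import Relation.Nullary using (Dec; yes; no)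
open import Relation.Nullary.Decidable using (_×-dec_; _⊎-dec_)

sumBelow : ℕ → (ℕ → ℕ) → ℕ
sumBelow zero    f = 0
sumBelow (suc N) f = f N + sumBelow N f

sumBelow-cong : ∀ N {f g : ℕ → ℕ} → (∀ v → f v ≡ g v) → sumBelow N f ≡ sumBelow N g
sumBelow-cong zero    f≡g = refl
sumBelow-cong (suc N) f≡g = cong₂ _+_ (f≡g N) (sumBelow-cong N f≡g)

sumBelow-+ : ∀ N (f g : ℕ → ℕ) → sumBelow N f + sumBelow N g ≡ sumBelow N (λ v → f v + g v)
sumBelow-+ zero    f g = refl
sumBelow-+ (suc N) f g =
  trans (interchange (f N) (sumBelow N f) (g N) (sumBelow N g))
        (cong (_+_ (f N + g N)) (sumBelow-+ N f g))

sumBelow-zero : ∀ N {f : ℕ → ℕ} → (∀ v → v < N → f v ≡ 0) → sumBelow N f ≡ 0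
sumBelow-zero zero    f≡0 = refl
sumBelow-zero (suc N) f≡0 =
  cong₂ _+_ (f≡0 N ≤-refl) (sumBelow-zero N (λ v v<N → f≡0 v (m≤n⇒m≤1+n v<N)))

sumBelow-single : ∀ N {f : ℕ → ℕ} {v} → v < N → (∀ u → u ≢ v → f u ≡ 0) → sumBelow N f ≡ f v
sumBelow-single (suc N) {f} v<1+N f≡0 with m<1+n⇒m<n∨m≡n v<1+N
... | inj₁ v<N = trans (cong (_+ sumBelow N f) (f≡0 N (λ N≡v → <-irrefl (sym N≡v) v<N)))
                       (sumBelow-single N v<N f≡0)
... | inj₂ refl = trans (cong (_+_ (f N)) (sumBelow-zero N (λ u u<N → f≡0 u (<⇒≢ u<N))))
                        (+-identityʳ (f N))

sumBelow-mono-≤ : ∀ N {f g : ℕ → ℕ} → (∀ u → g u ≤ f u) → sumBelow N g ≤ sumBelow N f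
sumBelow-mono-≤ zero    g≤f = ≤-refl
sumBelow-mono-≤ (suc N) g≤f = +-mono-≤ (g≤f N) (sumBelow-mono-≤ N g≤f)

sumBelow-mono-< : ∀ N {f g : ℕ → ℕ} {v} → (∀ u → g u ≤ f u) → v < N → g v < f v →
  sumBelow N g < sumBelow N f
sumBelow-mono-< (suc N) g≤f v<1+N gv<fv with m<1+n⇒m<n∨m≡n v<1+N
... | inj₁ v<N  = +-mono-≤-< (g≤f N) (sumBelow-mono-< N g≤f v<N gv<fv)
... | inj₂ refl = +-mono-<-≤ gv<fv (sumBelow-mono-≤ N g≤f)

==-sound : ∀ {p q} → p == q ≡ true → p ≡ q
==-sound {mkLit x s} {mkLit y t} eq with x ≟ y | s ≟ᵇ t
==-sound refl | yes refl | yes refl = refl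
==-sound ()   | yes refl | no _
==-sound ()   | no _     | _

==-refl : ∀ p → p == p ≡ true
==-refl (mkLit x s) with x ≟ x | s ≟ᵇ s
... | yes _ | yes _ = refl
... | yes _ | no s≢s = ⊥-elim (s≢s refl)
... | no x≢x | _ = ⊥-elim (x≢x refl)

==-complete : ∀ {p q} → p ≡ q → p == q ≡ true
==-complete {p} refl = ==-refl p

==-false : ∀ {p q} → p ≢ q → p == q ≡ false
==-false {p} {q} p≢q with p == q in eq
... | true  = ⊥-elim (p≢q (==-sound eq))
... | false = refl

==-false⇒≢ : ∀ {p q} → p == q ≡ false → p ≢ q
==-false⇒≢ eq p≡q with trans (sym eq) (==-complete p≡q)
... | ()

==-sym : ∀ p q → p == q ≡ q == p
==-sym p q with p == q in eq
... | true  = sym (==-complete {q} {p} (sym (==-sound eq)))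
... | false = sym (==-false {q} {p} (λ q≡p → ==-false⇒≢ eq (sym q≡p)))

indicator : Bool → ℕ
indicator true  = 1
indicator false = 0

countᵇ-∷ : ∀ (f : Clause → Bool) C F → countᵇ f (C ∷ F) ≡ indicator (f C) + countᵇ f F
countᵇ-∷ f C F with f C
... | true  = refl
... | false = refl

count-witness : ∀ (f : Clause → Bool) F → 0 < countᵇ f F →
  Σ (Fin (length F)) λ i → f (lookup F i) ≡ true
count-witness f (C ∷ F) pos with f C in fC
... | true  = #0 , fC
... | false = let (i , fi) = count-witness f F pos in #s i , fi

data IsClause (p q : Lit) (C : Clause) : Set where
  in-order : l₁ C ≡ p → l₂ C ≡ q → IsClause p q C
  swapped  : l₁ C ≡ q → l₂ C ≡ p → IsClause p q C

-- If p occurs in C, the literals r with C = {p,r} are exactly the other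
-- literal q of C.  (p matching neither literal contradicts p∈C.)
partner : ∀ p C → containsᵇ p C ≡ true →
  Σ Lit λ q → IsClause p q C × (∀ r → isClauseᵇ p r C ≡ q == r)
partner p (mkClause a b a≁b) p∈C with p == a in p=a
... | true = b , in-order (sym p≡a) refl , other
  where
  p≡a : p ≡ a
  p≡a = ==-sound p=a
  b=p : b == p ≡ false
  b=p = ==-false (λ b≡p → a≁b (cong var (trans (sym p≡a) (sym b≡p))))
  other : ∀ r → isClauseᵇ p r (mkClause a b a≁b) ≡ b == r
  other r rewrite ==-sym a p | p=a | b=p | ∧-zeroʳ (a == r) = ∨-identityʳ (b == r)
partner p (mkClause a b a≁b) p∈C | false with p == b in p=b
... | true = a , swapped refl (sym (==-sound p=b)) , other
  where
  other : ∀ r → isClauseᵇ p r (mkClause a b a≁b) ≡ a == r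
  other r rewrite ==-sym a p | p=a | ==-sym b p | p=b = ∧-identityʳ (a == r)

-- If p does not occur in C, no clause {p,r} is C.  (The cases where p == a
-- or p == b holds contradict p∉C and are discarded by the coverage checker.)
no-partner : ∀ p C → containsᵇ p C ≡ false → ∀ r → isClauseᵇ p r C ≡ false
no-partner p (mkClause a b _) p∉C r with p == a in p=a | p == b in p=b
... | false | false rewrite ==-sym a p | p=a | ==-sym b p | p=b = ∧-zeroʳ (a == r)

isClause-sound : ∀ p q C → isClauseᵇ p q C ≡ true → IsClause p q C
isClause-sound p q C isC with containsᵇ p C in p∈C
... | false with trans (sym isC) (no-partner p C p∈C q)
...   | ()
isClause-sound p q C isC | true with partner p C p∈C
...   | q′ , q′-partner , eq = subst (λ r → IsClause p r C) (==-sound (trans (sym (eq q)) isC)) q′-partner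

matches : Lit → ℕ → ℕ
matches q v = indicator (q == mkLit v true) + indicator (q == mkLit v false)

matches-other : ∀ q v → var q ≢ v → matches q v ≡ 0
matches-other (mkLit w s) v w≢v with w ≟ v
... | yes w≡v = ⊥-elim (w≢v w≡v)
... | no _    = refl

matches-own : ∀ q → matches q (var q) ≡ 1
matches-own (mkLit w s) with w ≟ w
... | no w≢w = ⊥-elim (w≢w refl)
... | yes _ with s
...   | true  = refl
...   | false = refl

clause-split : ∀ N p C → var (l₁ C) < N → var (l₂ C) < N →
  indicator (containsᵇ p C) ≡
  sumBelow N (λ v → indicator (isClauseᵇ p (mkLit v true) C) + indicator (isClauseᵇ p (mkLit v false) C))
clause-split N p C l₁<N l₂<N with containsᵇ p C in p∈C
... | false = sym (sumBelow-zero N (λ v _ →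
                cong₂ _+_ (cong indicator (no-partner p C p∈C _)) (cong indicator (no-partner p C p∈C _))))
... | true with partner p C p∈C
...   | q , q-partner , eq = sym (begin
  sumBelow N (λ v → indicator (isClauseᵇ p (mkLit v true) C) + indicator (isClauseᵇ p (mkLit v false) C))
                         ≡⟨ sumBelow-cong N (λ v → cong₂ _+_ (cong indicator (eq _)) (cong indicator (eq _))) ⟩
  sumBelow N (matches q) ≡⟨ sumBelow-single N (var-bound q-partner) (λ u u≢q → matches-other q u (λ q≡u → u≢q (sym q≡u))) ⟩
  matches q (var q)      ≡⟨ matches-own q ⟩
  1                      ∎)
  where
  open ≡-Reasoning
  var-bound : ∀ {q} → IsClause p q C → var q < N
  var-bound (in-order _ refl) = l₂<N
  var-bound (swapped refl _)  = l₁<N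

Bounded : Formula → ℕ → Set
Bounded F N = All (λ C → var (l₁ C) < N × var (l₂ C) < N) F

Bounded-mono : ∀ {F N M} → Bounded F N → N ≤ M → Bounded F M
Bounded-mono bd N≤M = All.map (λ (l₁<N , l₂<N) → <-≤-trans l₁<N N≤M , <-≤-trans l₂<N N≤M) bd

varBound : Formula → ℕ
varBound []      = 0
varBound (C ∷ F) = suc (var (l₁ C)) ⊔ suc (var (l₂ C)) ⊔ varBound F

varBound-bounds : ∀ F → Bounded F (varBound F)
varBound-bounds []      = All.[]
varBound-bounds (C ∷ F) =
  (≤-trans (m≤m⊔n m₁ m₂) (m≤m⊔n (m₁ ⊔ m₂) m)  , ≤-trans (m≤n⊔m m₁ m₂) (m≤m⊔n (m₁ ⊔ m₂) m))
  ∷ Bounded-mono (varBound-bounds F) (m≤n⊔m (m₁ ⊔ m₂) m)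
  where
  m₁ m₂ m : ℕ
  m₁ = suc (var (l₁ C))
  m₂ = suc (var (l₂ C))
  m  = varBound F

-- c(p) = Σ_v (c(pv) + c(pv̄)): every clause containing p is {p,r} for
-- exactly one literal r.
occurrences-split : ∀ N p F → Bounded F N →
  c₁ F p ≡ sumBelow N (λ v → c₂ F p (mkLit v true) + c₂ F p (mkLit v false))
occurrences-split N p []      _ = sym (sumBelow-zero N (λ _ _ → refl))
occurrences-split N p (C ∷ F) ((l₁<N , l₂<N) ∷ bd) = begin
  c₁ (C ∷ F) p
    ≡⟨ countᵇ-∷ (containsᵇ p) C F ⟩
  indicator (containsᵇ p C) + c₁ F p
    ≡⟨ cong₂ _+_ (clause-split N p C l₁<N l₂<N) (occurrences-split N p F bd) ⟩
  sumBelow N (λ v → inC v true + inC v false) + sumBelow N (λ v → c₂ F p (v ⁺) + c₂ F p (v ⁻))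
    ≡⟨ sumBelow-+ N _ _ ⟩
  sumBelow N (λ v → (inC v true + inC v false) + (c₂ F p (v ⁺) + c₂ F p (v ⁻)))
    ≡⟨ sumBelow-cong N (λ v → trans (interchange (inC v true) (inC v false) (c₂ F p (v ⁺)) (c₂ F p (v ⁻)))
                                    (sym (cong₂ _+_ (countᵇ-∷ (isClauseᵇ p (v ⁺)) C F)
                                                    (countᵇ-∷ (isClauseᵇ p (v ⁻)) C F)))) ⟩
  sumBelow N (λ v → c₂ (C ∷ F) p (v ⁺) + c₂ (C ∷ F) p (v ⁻))
    ∎
  where
  open ≡-Reasoning
  _⁺ _⁻ : ℕ → Lit
  v ⁺ = mkLit v true
  v ⁻ = mkLit v false
  inC : ℕ → Bool → ℕ
  inC v s = indicator (isClauseᵇ p (mkLit v s) C)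

clause-position : ∀ F p q → 0 < c₂ F p q → Σ (Fin (length F)) λ i → IsClause p q (lookup F i)
clause-position F p q pos with count-witness (isClauseᵇ p q) F pos
... | i , isC = i , isClause-sound p q (lookup F i) isC

count⇒Edge : ∀ F x v s t → 0 < c₂ F (mkLit x s) (mkLit v t) → Edge F x v
count⇒Edge F x v s t pos with clause-position F (mkLit x s) (mkLit v t) pos
... | i , isC = lose (∈-lookup i) (variables isC)
  where
  variables : ∀ {C} → IsClause (mkLit x s) (mkLit v t) C →
    ((var (l₁ C) ≡ x) × (var (l₂ C) ≡ v)) ⊎ ((var (l₁ C) ≡ v) × (var (l₂ C) ≡ x))
  variables (in-order e₁ e₂) = inj₁ (cong var e₁ , cong var e₂)
  variables (swapped e₁ e₂)  = inj₂ (cong var e₁ , cong var e₂)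

Edge? : ∀ F x y → Dec (Edge F x y)
Edge? F x y = any? (λ C → ((var (l₁ C) ≟ x) ×-dec (var (l₂ C) ≟ y))
                       ⊎-dec ((var (l₁ C) ≟ y) ×-dec (var (l₂ C) ≟ x))) F

no-edge⇒no-clause : ∀ F x v s t → ¬ Edge F x v → c₂ F (mkLit x s) (mkLit v t) ≡ 0
no-edge⇒no-clause F x v s t ¬xv with c₂ F (mkLit x s) (mkLit v t) ≟ 0
... | yes none = none
... | no some  = ⊥-elim (¬xv (count⇒Edge F x v s t (n≢0⇒n>0 some)))

first∈ : ∀ {p q C} → IsClause p q C → p ∈C C
first∈ (in-order e _) = inj₁ (sym e)
first∈ (swapped _ e)  = inj₂ (sym e)

second∈ : ∀ {p q C} → IsClause p q C → q ∈C C
second∈ (in-order _ e) = inj₂ (sym e)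
second∈ (swapped e _)  = inj₁ (sym e)

-- A clause has no complementary pair, so it never conflicts with itself.
no-self-conflict : ∀ C → ¬ Conflict C C
no-self-conflict C (mkLit x s , inj₁ e , inj₁ e′) = not-¬ refl (cong pol (trans e (sym e′)))
no-self-conflict C (mkLit x s , inj₂ e , inj₂ e′) = not-¬ refl (cong pol (trans e (sym e′)))
no-self-conflict C (mkLit x s , inj₁ e , inj₂ e′) = distinct C (trans (sym (cong var e)) (cong var e′))
no-self-conflict C (mkLit x s , inj₂ e , inj₁ e′) = distinct C (trans (sym (cong var e′)) (cong var e))

-- The clauses xv, xv̄, x̄u, x̄ū pairwise conflict (via v, u or x), so a
-- formula containing all four contains a semicomplete sub-multiset.
four-clauses-semicomplete : ∀ F x v u →
  0 < c₂ F (mkLit x true)  (mkLit v true) → 0 < c₂ F (mkLit x true)  (mkLit v false) →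
  0 < c₂ F (mkLit x false) (mkLit u true) → 0 < c₂ F (mkLit x false) (mkLit u false) →
  ContainsSemicomplete F
four-clauses-semicomplete F x v u xv xv̄ x̄u x̄ū = pos , injective , conflict
  where
  P₁ : Σ (Fin (length F)) λ i → IsClause (mkLit x true)  (mkLit v true)  (lookup F i)
  P₂ : Σ (Fin (length F)) λ i → IsClause (mkLit x true)  (mkLit v false) (lookup F i)
  P₃ : Σ (Fin (length F)) λ i → IsClause (mkLit x false) (mkLit u true)  (lookup F i)
  P₄ : Σ (Fin (length F)) λ i → IsClause (mkLit x false) (mkLit u false) (lookup F i)
  P₁ = clause-position F (mkLit x true)  (mkLit v true)  xv
  P₂ = clause-position F (mkLit x true)  (mkLit v false) xv̄
  P₃ = clause-position F (mkLit x false) (mkLit u true)  x̄u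
  P₄ = clause-position F (mkLit x false) (mkLit u false) x̄ū
  pos : Fin 4 → Fin (length F)
  pos #0                = proj₁ P₁
  pos (#s #0)           = proj₁ P₂
  pos (#s (#s #0))      = proj₁ P₃
  pos (#s (#s (#s #0))) = proj₁ P₄
  conflict : ∀ i j → i ≢ j → Conflict (lookup F (pos i)) (lookup F (pos j))
  conflict #0                #0                i≢i = ⊥-elim (i≢i refl)
  conflict #0                (#s #0)           _   = mkLit v true  , second∈ (proj₂ P₁) , second∈ (proj₂ P₂)
  conflict #0                (#s (#s #0))      _   = mkLit x true  , first∈ (proj₂ P₁)  , first∈ (proj₂ P₃)
  conflict #0                (#s (#s (#s #0))) _   = mkLit x true  , first∈ (proj₂ P₁)  , first∈ (proj₂ P₄)
  conflict (#s #0)           #0                _   = mkLit v false , second∈ (proj₂ P₂) , second∈ (proj₂ P₁)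
  conflict (#s #0)           (#s #0)           i≢i = ⊥-elim (i≢i refl)
  conflict (#s #0)           (#s (#s #0))      _   = mkLit x true  , first∈ (proj₂ P₂)  , first∈ (proj₂ P₃)
  conflict (#s #0)           (#s (#s (#s #0))) _   = mkLit x true  , first∈ (proj₂ P₂)  , first∈ (proj₂ P₄)
  conflict (#s (#s #0))      #0                _   = mkLit x false , first∈ (proj₂ P₃)  , first∈ (proj₂ P₁)
  conflict (#s (#s #0))      (#s #0)           _   = mkLit x false , first∈ (proj₂ P₃)  , first∈ (proj₂ P₂)
  conflict (#s (#s #0))      (#s (#s #0))      i≢i = ⊥-elim (i≢i refl)
  conflict (#s (#s #0))      (#s (#s (#s #0))) _   = mkLit u true  , second∈ (proj₂ P₃) , second∈ (proj₂ P₄)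
  conflict (#s (#s (#s #0))) #0                _   = mkLit x false , first∈ (proj₂ P₄)  , first∈ (proj₂ P₁)
  conflict (#s (#s (#s #0))) (#s #0)           _   = mkLit x false , first∈ (proj₂ P₄)  , first∈ (proj₂ P₂)
  conflict (#s (#s (#s #0))) (#s (#s #0))      _   = mkLit u false , second∈ (proj₂ P₄) , second∈ (proj₂ P₃)
  conflict (#s (#s (#s #0))) (#s (#s (#s #0))) i≢i = ⊥-elim (i≢i refl)
  -- distinct indices conflict, equal positions would give a self-conflict
  injective : ∀ i j → pos i ≡ pos j → i ≡ j
  injective i j same with i Fin.≟ j
  ... | yes i≡j = i≡j
  ... | no  i≢j = ⊥-elim (no-self-conflict (lookup F (pos j))
                    (subst (λ k → Conflict (lookup F k) (lookup F (pos j))) same (conflict i j i≢j)))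

Balanced : (a b c d : ℕ → ℕ) → Set
Balanced a b c d = ∀ v → b v + c v ≡ a v + d v

Unmixed : (a b c d : ℕ → ℕ) → Set
Unmixed a b c d = ∀ v u → 0 < a v → 0 < b v → 0 < c u → 0 < d u → ⊥

one-vanishes : ∀ m n → (0 < m → 0 < n → ⊥) → m ≡ 0 ⊎ n ≡ 0
one-vanishes zero    n       _        = inj₁ refl
one-vanishes (suc m) zero    _        = inj₂ refl
one-vanishes (suc m) (suc n) not-both = ⊥-elim (not-both (s≤s z≤n) (s≤s z≤n))

module _ (a b c d : ℕ → ℕ) (balanced : Balanced a b c d) where
  open ≤-Reasoning

  excess-transfers : ∀ {v} → c v < a v → d v < b v
  excess-transfers {v} c<a = +-cancelʳ-< (c v) (d v) (b v) (begin-strict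
    d v + c v <⟨ +-monoʳ-< (d v) c<a ⟩
    d v + a v ≡⟨ +-comm (d v) (a v) ⟩
    a v + d v ≡⟨ balanced v ⟨
    b v + c v ∎)

  dominated : ∀ w → c w ≡ 0 ⊎ d w ≡ 0 → c w + d w ≤ a w + b w
  dominated w (inj₁ c≡0) = begin
    c w + d w ≡⟨ cong (_+ d w) c≡0 ⟩
    d w       ≤⟨ m≤n+m (d w) (a w) ⟩
    a w + d w ≡⟨ balanced w ⟨
    b w + c w ≡⟨ cong (_+_ (b w)) c≡0 ⟩
    b w + 0   ≡⟨ +-identityʳ (b w) ⟩
    b w       ≤⟨ m≤n+m (b w) (a w) ⟩
    a w + b w ∎
  dominated w (inj₂ d≡0) = begin
    c w + d w ≡⟨ cong (_+_ (c w)) d≡0 ⟩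
    c w + 0   ≡⟨ +-identityʳ (c w) ⟩
    c w       ≤⟨ m≤n+m (c w) (b w) ⟩
    b w + c w ≡⟨ balanced w ⟩
    a w + d w ≡⟨ cong (_+_ (a w)) d≡0 ⟩
    a w + 0   ≡⟨ +-identityʳ (a w) ⟩
    a w       ≤⟨ m≤m+n (a w) (b w) ⟩
    a w + b w ∎

  -- An excess of a over c at some v < N makes a v, b v > 0; unmixedness then
  -- makes every index dominated, so the (a,b)-side has the strictly larger sum.
  excess⇒larger-sum : ∀ N → Unmixed a b c d → ∀ {v} → v < N → c v < a v →
    sumBelow N (λ u → c u + d u) < sumBelow N (λ u → a u + b u)
  excess⇒larger-sum N unmixed {v} v<N c<a =
    sumBelow-mono-< N (λ u → dominated u (one-vanishes (c u) (d u) (unmixed v u a>0 b>0))) v<N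
                    (+-mono-< c<a d<b)
    where
    d<b : d v < b v
    d<b = excess-transfers c<a
    a>0 : 0 < a v
    a>0 = m<n⇒0<n c<a
    b>0 : 0 < b v
    b>0 = m<n⇒0<n d<b

-- A balanced unmixed profile with equal side sums is symmetric: a = c and b = d
-- below N.  An excess in either direction would make one side sum larger.
balanced-profile-symmetric : ∀ N (a b c d : ℕ → ℕ) → Balanced a b c d → Unmixed a b c d →
  sumBelow N (λ u → a u + b u) ≡ sumBelow N (λ u → c u + d u) →
  ∀ {v} → v < N → a v ≡ c v × b v ≡ d v
balanced-profile-symmetric N a b c d balanced unmixed equal-sums {v} v<N with <-cmp (a v) (c v)
... | tri≈ _ a≡c _ = a≡c , +-cancelʳ-≡ (c v) (b v) (d v) (begin
  b v + c v ≡⟨ balanced v ⟩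
  a v + d v ≡⟨ cong (_+ d v) a≡c ⟩
  c v + d v ≡⟨ +-comm (c v) (d v) ⟩
  d v + c v ∎)
  where open ≡-Reasoning
... | tri> _ _ c<a = ⊥-elim (<-irrefl (sym equal-sums) (excess⇒larger-sum a b c d balanced N unmixed v<N c<a))
... | tri< a<c _ _ = ⊥-elim (<-irrefl equal-sums (excess⇒larger-sum c d a b reversed N
                                                  (λ v u c>0 d>0 a>0 b>0 → unmixed u v a>0 b>0 c>0 d>0) v<N a<c))
  where
  reversed : Balanced c d a b
  reversed w = trans (+-comm (d w) (a w)) (trans (sym (balanced w)) (+-comm (b w) (c w)))

profile : Formula → ℕ → Bool → Bool → ℕ → ℕ
profile F x s t v = c₂ F (mkLit x s) (mkLit v t)

module _ (F : Formula) (x : ℕ) where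
  private
    a b c d : ℕ → ℕ
    a = profile F x true  true
    b = profile F x true  false
    c = profile F x false true
    d = profile F x false false

  insignificant⇒isolated : Insignificant F x → IsolatedInG⁰ F x
  insignificant⇒isolated insignificant v _ = ℤ.i≡j⇒i-j≡0 (cong +_ (begin
    b v + c v ≡⟨ cong₂ _+_ (insignificant (mkLit v false)) (sym (insignificant (mkLit v true))) ⟩
    d v + a v ≡⟨ +-comm (d v) (a v) ⟩
    a v + d v ∎))
    where open ≡-Reasoning

  insignificant⇒unweighted : Insignificant F x → wV F x ≡ + 0
  insignificant⇒unweighted insignificant = ℤ.i≡j⇒i-j≡0 (cong +_ (begin
    c₁ F (mkLit x true)                     ≡⟨ occurrences-split N (mkLit x true) F (varBound-bounds F) ⟩
    sumBelow N (λ v → a v + b v)            ≡⟨ sumBelow-cong N (λ v → cong₂ _+_ (insignificant (mkLit v true))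
                                                                              (insignificant (mkLit v false))) ⟩
    sumBelow N (λ v → c v + d v)            ≡⟨ occurrences-split N (mkLit x false) F (varBound-bounds F) ⟨
    c₁ F (mkLit x false)                    ∎))
    where
    open ≡-Reasoning
    N : ℕ
    N = varBound F

  -- Isolation in G⁰ balances the profile: on an edge xv because w(xv) = 0,
  -- and on a non-edge because all four counts vanish.
  isolated⇒balanced : IsolatedInG⁰ F x → Balanced a b c d
  isolated⇒balanced isolated v with Edge? F x v
  ... | yes xv  = ℤ.+-injective (ℤ.i-j≡0⇒i≡j _ _ (isolated v xv))
  ... | no ¬xv = trans (cong₂ _+_ (absent true false) (absent false true))
                       (sym (cong₂ _+_ (absent true true) (absent false false)))
    where
    absent : ∀ s t → profile F x s t v ≡ 0
    absent s t = no-edge⇒no-clause F x v s t ¬xv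

  no-semicomplete⇒unmixed : ¬ ContainsSemicomplete F → Unmixed a b c d
  no-semicomplete⇒unmixed no-semicomplete v u xv xv̄ x̄u x̄ū =
    no-semicomplete (four-clauses-semicomplete F x v u xv xv̄ x̄u x̄ū)

  -- The converse direction: the profile is balanced and unmixed, and w(x) = 0
  -- equates its side sums, so it is symmetric, which is insignificance.
  isolated-unweighted⇒insignificant : ¬ ContainsSemicomplete F →
    IsolatedInG⁰ F x → wV F x ≡ + 0 → Insignificant F x
  isolated-unweighted⇒insignificant no-semicomplete isolated unweighted (mkLit v t) =
    by-polarity t (balanced-profile-symmetric N a b c d (isolated⇒balanced isolated)
                     (no-semicomplete⇒unmixed no-semicomplete) equal-sums (s≤s (m≤m+n v (varBound F))))
    where
    N : ℕ
    N = suc v + varBound F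
    bounded : Bounded F N
    bounded = Bounded-mono (varBound-bounds F) (m≤n+m (varBound F) (suc v))
    equal-sums : sumBelow N (λ u → a u + b u) ≡ sumBelow N (λ u → c u + d u)
    equal-sums = trans (sym (occurrences-split N (mkLit x true) F bounded))
                 (trans (ℤ.+-injective (ℤ.i-j≡0⇒i≡j _ _ unweighted))
                        (occurrences-split N (mkLit x false) F bounded))
    by-polarity : ∀ t → a v ≡ c v × b v ≡ d v → profile F x true t v ≡ profile F x false t v
    by-polarity true  = proj₁
    by-polarity false = proj₂

lemma5p5 : (F : Formula) → ¬ ContainsSemicomplete F → (x : ℕ) → x ∈Var F →
    Insignificant F x ⇔ (IsolatedInG⁰ F x × wV F x ≡ + 0)
lemma5p5 F no-semicomplete x _ = mk⇔
  (λ insignificant → insignificant⇒isolated F x insignificant , insignificant⇒unweighted F x insignificant)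
  (λ (isolated , unweighted) → isolated-unweighted⇒insignificant F x no-semicomplete isolated unweighted)
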